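{- Let $G$ be a connected graph and let $t\ge 3$ be an integer. Let $B$ be a local metric basis of $C_t\boxtimes G$ with $|B|=b$, and let $u_{i_1},u_{i_2},\ldots,u_{i_b}$ be the first components of the elements of $B$ (listed with multiplicity), where $i_1\le i_2\le\cdots\le i_b$. Then for any $l\in\{1,\dots,b\}$, $d_{C_t}(u_{i_{l+2}},u_{i_l})\le 2D(G)$, where the subscripts of $i$ are taken modulo $b$.
   Context: $C_t$ is the cycle with vertices $u_1,\dots,u_t$, $u_i\sim u_{i+1}$ for $1\le i\le t-1$ and $u_1\sim u_t$. $D(G)$ is the diameter of $G$. A set $S$ is a local metric generator for a connected graph $X$ if for every two adjacent vertices $x,y$ there is $s\in S$ with $d_X(s,x)\ne d_X(s,y)$; a local metric basis is one of minimum cardinality. The strong product $C_t\boxtimes G$ has vertex set $V(C_t)\times V(G)$, with $(a,b)\sim(c,d)$ iff ($a=c$ and $b\sim d$) or ($b=d$ and $a\sim c$) or ($a\sim c$ and $b\sim d$). -}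

module Defs where

open import Data.Nat using (ℕ; zero; suc; _+_; _≤_)
open import Data.Nat.DivMod using (_mod_)
open import Data.Fin using (Fin; toℕ)
open import Data.Product using (_×_; Σ; ∃; ∃-syntax; _,_)
open import Data.Sum using (_⊎_)
open import Data.List using (List; length)
open import Data.List.Membership.Propositional using (_∈_)
open import Data.List.Relation.Unary.Unique.Propositional using (Unique)
open import Relation.Binary.PropositionalEquality using (_≡_; _≢_)
open import Relation.Nullary using (¬_)

Graph : Set → Set₁
Graph V = V → V → Set

IsSimple : {V : Set} → Graph V → Set
IsSimple {V} G = (∀ x y → G x y → G y x) × (∀ x → ¬ G x x)

data Walk {V : Set} (G : Graph V) : V → V → ℕ → Set where
  here : ∀ {x} → Walk G x x zero
  step : ∀ {x y z k} → G x y → Walk G y z k → Walk G x z (suc k)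

Connected : {V : Set} → Graph V → Set
Connected {V} G = ∀ (x y : V) → ∃[ k ] Walk G x y k

Dist : {V : Set} → Graph V → V → V → ℕ → Set
Dist G x y k = Walk G x y k × (∀ m → Walk G x y m → k ≤ m)

IsDiameter : {V : Set} → Graph V → ℕ → Set
IsDiameter {V} G D =
  (∀ (x y : V) k → Dist G x y k → k ≤ D) × (∃[ x ] ∃[ y ] Dist G x y D)

-- cycle C_t on Fin t : vertex i (0-based) is u_{i+1}; u_i ~ u_{i+1}, u_1 ~ u_t
CycleAdj : (t : ℕ) → Graph (Fin t)
CycleAdj t i j =
  (suc (toℕ i) ≡ toℕ j) ⊎ (suc (toℕ j) ≡ toℕ i)
  ⊎ ((toℕ i ≡ 0 × suc (toℕ j) ≡ t) ⊎ (toℕ j ≡ 0 × suc (toℕ i) ≡ t))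

Cycle : (t : ℕ) → Graph (Fin t)
Cycle = CycleAdj

StrongProduct : {V W : Set} → Graph V → Graph W → Graph (V × W)
StrongProduct H G (a , b) (c , d) =
  (a ≡ c × G b d) ⊎ (b ≡ d × H a c) ⊎ (H a c × G b d)

IsLocalMetricGenerator : {V : Set} → Graph V → List V → Set
IsLocalMetricGenerator {V} X S =
  ∀ (x y : V) → X x y →
    ∃[ s ] (s ∈ S × ∃[ k₁ ] ∃[ k₂ ] (Dist X s x k₁ × Dist X s y k₂ × k₁ ≢ k₂))

IsLocalMetricBasis : {V : Set} → Graph V → List V → Set
IsLocalMetricBasis {V} X B =
  Unique B × IsLocalMetricGenerator X B
  × (∀ (S : List V) → Unique S → IsLocalMetricGenerator X S → length B ≤ length S)

plus2 : ∀ {b} → Fin b → Fin b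
plus2 {suc b} l = (toℕ l + 2) mod (suc b)

-- Write x = u_{i_l}, z = u_{i_{l+2}} and suppose d(z, x) > 2D(G). As the first coordinates are
-- sorted, every basis vertex except possibly one lying over u_{i_{l+1}} lies over the arc A running
-- forward from z to x, and the complementary arc is longer than 2D. On it pick j at cycle distance
-- at least D from all of A; there are two candidates, so j can avoid u_{i_{l+1}}. Let h₀ be the
-- second coordinate of the exceptional basis vertex and g a neighbour of h₀. Distances in C_t ⊠ G
-- are maxima of the coordinate distances, so no basis vertex distinguishes (j, h₀) from (j, g).
-- If G is a single vertex, {u₁, u₂} is already a local metric generator, so b ≤ 2 and l + 2 ≡ l.
-- Distances in G exist only up to double negation (its adjacency is not decidable), which is
-- harmless because the conclusion is decidable.
module Submission where

open import Data.Empty using (⊥; ⊥-elim)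
open import Data.Fin using (Fin; zero; suc; toℕ; fromℕ<)
open import Data.Fin.Properties using (≤-totalOrder; toℕ-injective; toℕ-fromℕ<; toℕ<n)
  renaming (_≟_ to _≟ᶠ_)
open import Data.List using (List; []; _∷_; length; map; lookup; filter)
open import Data.List.Membership.Propositional using (_∈_)
open import Data.List.Membership.Propositional.Properties using (∈-map⁺)
open import Data.List.Properties using (filter-reject; filter-some; length-map)
open import Data.List.Relation.Binary.Permutation.Propositional using (_↭_)
open import Data.List.Relation.Binary.Permutation.Propositional.Properties using (filter-↭; ↭-length)
open import Data.List.Relation.Unary.All using ([]; _∷_)
open import Data.List.Relation.Unary.AllPairs using ([]; _∷_)
open import Data.List.Relation.Unary.Any as Any using (here; there)
open import Data.List.Relation.Unary.Sorted.TotalOrder using (Sorted)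
open import Data.List.Relation.Unary.Sorted.TotalOrder.Properties using (lookup-mono-≤)
open import Data.Nat
  using (ℕ; zero; suc; pred; _+_; _*_; _∸_; _⊓_; _≤_; _<_; _≤?_; z≤n; s≤s; z<s; NonZero; >-nonZero⁻¹)
open import Data.Nat.DivMod
  using (_%_; _mod_; m%n%n≡m%n; [m+n]%n≡m%n; %-distribˡ-+; m%n<n; m%n≤m; m<n⇒m%n≡m; n%n≡0)
open import Data.Nat.Induction using (<-rec)
open import Data.Nat.Properties hiding (≤-totalOrder)
open import Algebra.Properties.CommutativeSemigroup +-commutativeSemigroup using (x∙yz≈zx∙y)
open import Data.Product using (_×_; _,_; proj₁; proj₂; ∃; ∃-syntax)
open import Data.Sum as Sum using (_⊎_; inj₁; inj₂)
open import Defs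
open import Function using (_∘_)
open import Level using (0ℓ)
open import Relation.Binary.Bundles using (Setoid)
import Relation.Binary.Construct.On as On
open import Relation.Binary.Definitions using (Tri; tri<; tri≈; tri>)
open import Relation.Binary.PropositionalEquality
import Relation.Binary.Reasoning.Setoid as SetoidReasoning
open import Relation.Nullary using (¬_; Dec; yes; no)
open import Relation.Unary using (Decidable)
open import Relation.Unary.Properties using (∁?)

-- Walks and distances

module _ {V : Set} {G : Graph V} where

  walk-snoc : ∀ {x y z m} → Walk G x y m → G y z → Walk G x z (suc m)
  walk-snoc here       e′ = step e′ here
  walk-snoc (step e w) e′ = step e (walk-snoc w e′)

  walk-reverse : (∀ {x y} → G x y → G y x) → ∀ {x y m} → Walk G x y m → Walk G y x m
  walk-reverse G-sym here       = here
  walk-reverse G-sym (step e w) = walk-snoc (walk-reverse G-sym w) (G-sym e)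

  walk₀⇒≡ : ∀ {x y} → Walk G x y 0 → x ≡ y
  walk₀⇒≡ here = refl

  Dist-unique : ∀ {x y k m} → Dist G x y k → Dist G x y m → k ≡ m
  Dist-unique (w , k-min) (w′ , m-min) = ≤-antisym (k-min _ w′) (m-min _ w)

  walk⇒¬¬Dist : ∀ {x y k} → Walk G x y k → ¬ ¬ ∃ (Dist G x y)
  walk⇒¬¬Dist {x} {y} w ¬dist = <-rec (λ k → ¬ Walk G x y k) shortest _ w
    where
      shortest : ∀ k → (∀ {j} → j < k → ¬ Walk G x y j) → ¬ Walk G x y k
      shortest k shorter wₖ = ¬dist (k , wₖ , λ j wⱼ → ≮⇒≥ (λ j<k → shorter j<k wⱼ))

  ¬¬walk-within-diameter : Connected G → ∀ {D} → IsDiameter G D →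
                           ∀ x y → ¬ ¬ (∃[ m ] m ≤ D × Walk G x y m)
  ¬¬walk-within-diameter conn diam x y ¬short =
    walk⇒¬¬Dist (proj₂ (conn x y)) λ (m , dist) → ¬short (m , proj₁ diam x y m dist , proj₁ dist)

  connected⇒no-isolated : Connected G → (∀ x → ∃[ y ] x ≢ y) → ∀ x → ∃ (G x)
  connected⇒no-isolated conn other x with conn x (proj₁ (other x))
  ... | zero  , w        = ⊥-elim (proj₂ (other x) (walk₀⇒≡ w))
  ... | suc _ , step e _ = _ , e

-- Strong products

module _ {V W : Set} {H : Graph V} {G : Graph W} where

  walk-proj₁ : ∀ {x y k} → Walk (StrongProduct H G) x y k →
               ∃[ m ] m ≤ k × Walk H (proj₁ x) (proj₁ y) m
  walk-proj₁ here = 0 , z≤n , here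
  walk-proj₁ (step (inj₁ (refl , _)) w) with walk-proj₁ w
  ... | m , m≤k , w′ = m , m≤n⇒m≤1+n m≤k , w′
  walk-proj₁ (step (inj₂ (inj₁ (_ , e))) w) with walk-proj₁ w
  ... | m , m≤k , w′ = suc m , s≤s m≤k , step e w′
  walk-proj₁ (step (inj₂ (inj₂ (e , _))) w) with walk-proj₁ w
  ... | m , m≤k , w′ = suc m , s≤s m≤k , step e w′

  walk-⊠ : ∀ {a j m h g m′} → Walk H a j m → Walk G h g m′ → m′ ≤ m →
           Walk (StrongProduct H G) (a , h) (j , g) m
  walk-⊠ here       here         _          = here
  walk-⊠ (step e w) here         _          = step (inj₂ (inj₁ (refl , e))) (walk-⊠ w here z≤n)
  walk-⊠ (step e w) (step e′ w′) (s≤s m′≤m) = step (inj₂ (inj₂ (e , e′))) (walk-⊠ w w′ m′≤m)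

  Dist-⊠ : ∀ {a j m h g m′} → Dist H a j m → Walk G h g m′ → m′ ≤ m →
           Dist (StrongProduct H G) (a , h) (j , g) m
  Dist-⊠ (w , m-min) w′ m′≤m = walk-⊠ w w′ m′≤m , λ k wₖ →
    let (m₁ , m₁≤k , w₁) = walk-proj₁ wₖ in ≤-trans (m-min m₁ w₁) m₁≤k

  ⊠-equidistant : ∀ {a j m h g₁ g₂ m₁ m₂ k₁ k₂} → Dist H a j m →
                  Walk G h g₁ m₁ → m₁ ≤ m → Walk G h g₂ m₂ → m₂ ≤ m →
                  Dist (StrongProduct H G) (a , h) (j , g₁) k₁ →
                  Dist (StrongProduct H G) (a , h) (j , g₂) k₂ → k₁ ≡ k₂
  ⊠-equidistant dist w₁ m₁≤m w₂ m₂≤m d₁ d₂ =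
    trans (Dist-unique d₁ (Dist-⊠ dist w₁ m₁≤m)) (Dist-unique (Dist-⊠ dist w₂ m₂≤m) d₂)

-- Distances in the cycle

Cycle-sym : ∀ {t} {a b : Fin t} → Cycle t a b → Cycle t b a
Cycle-sym (inj₁ e)               = inj₂ (inj₁ e)
Cycle-sym (inj₂ (inj₁ e))        = inj₁ e
Cycle-sym (inj₂ (inj₂ (inj₁ e))) = inj₂ (inj₂ (inj₂ e))
Cycle-sym (inj₂ (inj₂ (inj₂ e))) = inj₂ (inj₂ (inj₁ e))

module CycleMetric (t : ℕ) .{{_ : NonZero t}} where

  ≈-setoid : Setoid 0ℓ 0ℓ
  ≈-setoid = On.setoid (setoid ℕ) (_% t)

  open Setoid ≈-setoid using (_≈_)

  %-≈ : ∀ m → m % t ≈ m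
  %-≈ m = m%n%n≡m%n m t

  +t-≈ : ∀ m → m + t ≈ m
  +t-≈ m = [m+n]%n≡m%n m t

  t≈0 : t ≈ 0
  t≈0 = trans (n%n≡0 t) (sym (m<n⇒m%n≡m (>-nonZero⁻¹ t)))

  +-congˡ-≈ : ∀ o {m n} → m ≈ n → o + m ≈ o + n
  +-congˡ-≈ o {m} {n} m≈n = begin
      (o + m) % t          ≡⟨ %-distribˡ-+ o m t ⟩
      (o % t + m % t) % t  ≡⟨ cong (λ r → (o % t + r) % t) m≈n ⟩
      (o % t + n % t) % t  ≡⟨ %-distribˡ-+ o n t ⟨
      (o + n) % t          ∎
    where open ≡-Reasoning

  +-congʳ-≈ : ∀ o {m n} → m ≈ n → m + o ≈ n + o
  +-congʳ-≈ o {m} {n} m≈n = subst₂ _≈_ (+-comm o m) (+-comm o n) (+-congˡ-≈ o m≈n)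

  suc-cancel-≈ : ∀ {m n} → suc m ≈ suc n → m ≈ n
  suc-cancel-≈ {m} {n} 1+m≈1+n = begin
      m              ≈⟨ +t-≈ m ⟨
      m + t          ≡⟨ 1+k+pred-t m ⟨
      suc m + pred t ≈⟨ +-congʳ-≈ (pred t) 1+m≈1+n ⟩
      suc n + pred t ≡⟨ 1+k+pred-t n ⟩
      n + t          ≈⟨ +t-≈ n ⟩
      n              ∎
    where
      open SetoidReasoning ≈-setoid
      1+k+pred-t : ∀ k → suc k + pred t ≡ k + t
      1+k+pred-t k = trans (sym (+-suc k (pred t))) (cong (k +_) (suc-pred t))

  ≈⇒≡ : ∀ {m n} → m < t → n < t → m ≈ n → m ≡ n
  ≈⇒≡ {m} {n} m<t n<t m≈n = begin
      m      ≡⟨ m<n⇒m%n≡m m<t ⟨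
      m % t  ≡⟨ m≈n ⟩
      n % t  ≡⟨ m<n⇒m%n≡m n<t ⟩
      n      ∎
    where open ≡-Reasoning

  -- Forward distance: the number of steps from a to b in the direction u₁ → u₂ → ⋯ → u_t → u₁.
  fd : ℕ → ℕ → ℕ
  fd a b = (b + (t ∸ a)) % t

  fd<t : ∀ a b → fd a b < t
  fd<t a b = m%n<n (b + (t ∸ a)) t

  fd-correct : ∀ {a} b → a < t → fd a b + a ≈ b
  fd-correct {a} b a<t = begin
      fd a b + a       ≈⟨ +-congʳ-≈ a (%-≈ (b + (t ∸ a))) ⟩
      b + (t ∸ a) + a  ≡⟨ +-assoc b (t ∸ a) a ⟩
      b + (t ∸ a + a)  ≡⟨ cong (b +_) (m∸n+n≡m (<⇒≤ a<t)) ⟩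
      b + t            ≈⟨ +t-≈ b ⟩
      b                ∎
    where open SetoidReasoning ≈-setoid

  fd-unique : ∀ {a b d} → a < t → d + a ≈ b → fd a b ≡ d % t
  fd-unique {a} {b} {d} a<t d+a≈b = begin
      b + (t ∸ a)        ≈⟨ +-congʳ-≈ (t ∸ a) d+a≈b ⟨
      d + a + (t ∸ a)    ≡⟨ +-assoc d a (t ∸ a) ⟩
      d + (a + (t ∸ a))  ≡⟨ cong (d +_) (m+[n∸m]≡n (<⇒≤ a<t)) ⟩
      d + t              ≈⟨ +t-≈ d ⟩
      d                  ∎
    where open SetoidReasoning ≈-setoid

  fd-≡ : ∀ {a b d} → a < t → d < t → d + a ≈ b → fd a b ≡ d
  fd-≡ a<t d<t d+a≈b = trans (fd-unique a<t d+a≈b) (m<n⇒m%n≡m d<t)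

  fd-≤ : ∀ {a b d} → a < t → d + a ≈ b → fd a b ≤ d
  fd-≤ {d = d} a<t d+a≈b = subst (_≤ d) (sym (fd-unique a<t d+a≈b)) (m%n≤m d t)

  fd≡0⇒≡ : ∀ {a b} → a < t → b < t → fd a b ≡ 0 → a ≡ b
  fd≡0⇒≡ {a} {b} a<t b<t fd≡0 =
    ≈⇒≡ a<t b<t (subst (λ d → d + a ≈ b) fd≡0 (fd-correct b a<t))

  fd-flip : ∀ {a b} → a < t → b < t → 0 < fd a b → fd b a ≡ t ∸ fd a b
  fd-flip {a} {b} a<t b<t 0<L = fd-≡ b<t (∸-monoʳ-< 0<L (<⇒≤ (fd<t a b))) (begin
      t ∸ L + b        ≈⟨ +-congˡ-≈ (t ∸ L) (fd-correct b a<t) ⟨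
      t ∸ L + (L + a)  ≡⟨ +-assoc (t ∸ L) L a ⟨
      t ∸ L + L + a    ≡⟨ cong (_+ a) (m∸n+n≡m (<⇒≤ (fd<t a b))) ⟩
      t + a            ≡⟨ +-comm t a ⟩
      a + t            ≈⟨ +t-≈ a ⟩
      a                ∎)
    where
      open SetoidReasoning ≈-setoid
      L : ℕ
      L = fd a b

  fd-+ : ∀ {a b d} → a < t → b < t → a + d ≡ b → fd a b ≡ d
  fd-+ {a} {b} {d} a<t b<t a+d≡b = fd-≡ a<t
    (≤-<-trans (m≤n+m d a) (subst (_< t) (sym a+d≡b) b<t)) (cong (_% t) (trans (+-comm d a) a+d≡b))

  ≤⇒fd≡∸ : ∀ {a b} → a ≤ b → b < t → fd a b ≡ b ∸ a
  ≤⇒fd≡∸ a≤b b<t = fd-+ (≤-<-trans a≤b b<t) b<t (m+[n∸m]≡n a≤b)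

  >⇒fd≡∸+ : ∀ {a b} → b < a → a < t → fd a b ≡ t ∸ a + b
  >⇒fd≡∸+ {a} {b} b<a a<t = fd-≡ a<t t∸a+b<t (begin
      t ∸ a + b + a    ≡⟨ +-assoc (t ∸ a) b a ⟩
      t ∸ a + (b + a)  ≡⟨ cong (t ∸ a +_) (+-comm b a) ⟩
      t ∸ a + (a + b)  ≡⟨ +-assoc (t ∸ a) a b ⟨
      t ∸ a + a + b    ≡⟨ cong (_+ b) (m∸n+n≡m (<⇒≤ a<t)) ⟩
      t + b            ≡⟨ +-comm t b ⟩
      b + t            ≈⟨ +t-≈ b ⟩
      b                ∎)
    where
      open SetoidReasoning ≈-setoid
      t∸a+b<t : t ∸ a + b < t
      t∸a+b<t = subst (t ∸ a + b <_) (m∸n+n≡m (<⇒≤ a<t)) (+-monoʳ-< (t ∸ a) b<a)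

  fd-relative : ∀ {z a} b → z < t → a < t → fd a b ≡ fd (fd z a) (fd z b)
  fd-relative {z} {a} b z<t a<t = fd-≡ a<t (fd<t α β) (begin
      e + a        ≈⟨ +-congˡ-≈ e (fd-correct a z<t) ⟨
      e + (α + z)  ≡⟨ +-assoc e α z ⟨
      e + α + z    ≈⟨ +-congʳ-≈ z (fd-correct β (fd<t z a)) ⟩
      β + z        ≈⟨ fd-correct b z<t ⟩
      b            ∎)
    where
      open SetoidReasoning ≈-setoid
      α β e : ℕ
      α = fd z a
      β = fd z b
      e = fd α β

  _⊕_ : Fin t → ℕ → Fin t
  a ⊕ d = (d + toℕ a) mod t

  ⊕-≈ : ∀ a d → d + toℕ a ≈ toℕ (a ⊕ d)
  ⊕-≈ a d = sym (trans (cong (_% t) (toℕ-fromℕ< _)) (%-≈ (d + toℕ a)))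

  fd-⊕ : ∀ a {d} → d < t → fd (toℕ a) (toℕ (a ⊕ d)) ≡ d
  fd-⊕ a d<t = fd-≡ (toℕ<n a) d<t (⊕-≈ a _)

  Cycle⇒≈ : ∀ {a b : Fin t} → Cycle t a b → suc (toℕ a) ≈ toℕ b ⊎ suc (toℕ b) ≈ toℕ a
  Cycle⇒≈ (inj₁ 1+a≡b)                       = inj₁ (cong (_% t) 1+a≡b)
  Cycle⇒≈ (inj₂ (inj₁ 1+b≡a))                = inj₂ (cong (_% t) 1+b≡a)
  Cycle⇒≈ (inj₂ (inj₂ (inj₁ (a≡0 , 1+b≡t)))) = inj₂ (subst₂ _≈_ (sym 1+b≡t) (sym a≡0) t≈0)
  Cycle⇒≈ (inj₂ (inj₂ (inj₂ (b≡0 , 1+a≡t)))) = inj₁ (subst₂ _≈_ (sym 1+a≡t) (sym b≡0) t≈0)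

  ≈⇒Cycle : ∀ {a b : Fin t} → suc (toℕ a) ≈ toℕ b → Cycle t a b
  ≈⇒Cycle {a} {b} 1+a≈b with m≤n⇒m<n∨m≡n (toℕ<n a)
  ... | inj₁ 1+a<t = inj₁ (≈⇒≡ 1+a<t (toℕ<n b) 1+a≈b)
  ... | inj₂ 1+a≡t = inj₂ (inj₂ (inj₂ (b≡0 , 1+a≡t)))
    where
      b≡0 : toℕ b ≡ 0
      b≡0 = ≈⇒≡ (toℕ<n b) (>-nonZero⁻¹ t) (trans (sym 1+a≈b) (subst (_≈ 0) (sym 1+a≡t) t≈0))

  forward-walk : ∀ d {a b : Fin t} → d + toℕ a ≈ toℕ b → Walk (Cycle t) a b d
  forward-walk zero    {a} {b} a≈b =
    subst (λ b → Walk (Cycle t) a b 0) (toℕ-injective (≈⇒≡ (toℕ<n a) (toℕ<n b) a≈b)) here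
  forward-walk (suc d) {a} {b} 1+d+a≈b = step (≈⇒Cycle (⊕-≈ a 1)) (forward-walk d (begin
      d + toℕ (a ⊕ 1)  ≈⟨ +-congˡ-≈ d (⊕-≈ a 1) ⟨
      d + suc (toℕ a)  ≡⟨ +-suc d (toℕ a) ⟩
      suc d + toℕ a    ≈⟨ 1+d+a≈b ⟩
      toℕ b            ∎))
    where open SetoidReasoning ≈-setoid

  walk⇒shift : ∀ {a b m} → Walk (Cycle t) a b m →
               ∃[ d ] d ≤ m × (d + toℕ a ≈ toℕ b ⊎ d + toℕ b ≈ toℕ a)
  walk⇒shift here = 0 , z≤n , inj₁ refl
  walk⇒shift {a} {b} (step {y = a₁} e w) with Cycle⇒≈ e | walk⇒shift w
  ... | inj₁ 1+a≈a₁ | d , d≤m , inj₁ d+a₁≈b = suc d , s≤s d≤m , inj₁ (begin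
          suc d + toℕ a    ≡⟨ +-suc d (toℕ a) ⟨
          d + suc (toℕ a)  ≈⟨ +-congˡ-≈ d 1+a≈a₁ ⟩
          d + toℕ a₁       ≈⟨ d+a₁≈b ⟩
          toℕ b            ∎)
    where open SetoidReasoning ≈-setoid
  ... | inj₂ 1+a₁≈a | d , d≤m , inj₂ d+b≈a₁ =
          suc d , s≤s d≤m , inj₂ (trans (+-congˡ-≈ 1 d+b≈a₁) 1+a₁≈a)
  ... | inj₁ 1+a≈a₁ | zero , _ , inj₂ b≈a₁ =
          1 , s≤s z≤n , inj₁ (trans 1+a≈a₁ (sym b≈a₁))
  ... | inj₂ 1+a₁≈a | zero , _ , inj₁ a₁≈b =
          1 , s≤s z≤n , inj₂ (trans (sym (+-congˡ-≈ 1 a₁≈b)) 1+a₁≈a)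
  ... | inj₁ 1+a≈a₁ | suc d , d<m , inj₂ 1+d+b≈a₁ =
          d , m<n⇒m≤1+n d<m , inj₂ (suc-cancel-≈ (trans 1+d+b≈a₁ (sym 1+a≈a₁)))
  ... | inj₂ 1+a₁≈a | suc d , d<m , inj₁ 1+d+a₁≈b = d , m<n⇒m≤1+n d<m , inj₁ (begin
          d + toℕ a         ≈⟨ +-congˡ-≈ d 1+a₁≈a ⟨
          d + suc (toℕ a₁)  ≡⟨ +-suc d (toℕ a₁) ⟩
          suc d + toℕ a₁    ≈⟨ 1+d+a₁≈b ⟩
          toℕ b             ∎)
    where open SetoidReasoning ≈-setoid

  cd : Fin t → Fin t → ℕ
  cd a b = fd (toℕ a) (toℕ b) ⊓ fd (toℕ b) (toℕ a)

  cd-≤-walk : ∀ {a b m} → Walk (Cycle t) a b m → cd a b ≤ m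
  cd-≤-walk {a} {b} w with walk⇒shift w
  ... | d , d≤m , inj₁ d+a≈b = ≤-trans (m⊓n≤m _ _) (≤-trans (fd-≤ (toℕ<n a) d+a≈b) d≤m)
  ... | d , d≤m , inj₂ d+b≈a = ≤-trans (m⊓n≤n _ _) (≤-trans (fd-≤ (toℕ<n b) d+b≈a) d≤m)

  cd-walk : ∀ a b → Walk (Cycle t) a b (cd a b)
  cd-walk a b with ⊓-sel (fd (toℕ a) (toℕ b)) (fd (toℕ b) (toℕ a))
  ... | inj₁ cd≡fd = subst (Walk (Cycle t) a b) (sym cd≡fd)
                       (forward-walk _ (fd-correct (toℕ b) (toℕ<n a)))
  ... | inj₂ cd≡fd = subst (Walk (Cycle t) a b) (sym cd≡fd)
                       (walk-reverse Cycle-sym (forward-walk _ (fd-correct (toℕ a) (toℕ<n b))))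

  Dist-cd : ∀ a b → Dist (Cycle t) a b (cd a b)
  Dist-cd a b = cd-walk a b , λ _ → cd-≤-walk

  cd-pos : ∀ {a b} → a ≢ b → 0 < cd a b
  cd-pos {a} {b} a≢b = n≢0⇒n>0 cd≢0
    where
      cd≢0 : cd a b ≢ 0
      cd≢0 cd≡0 with ⊓-sel (fd (toℕ a) (toℕ b)) (fd (toℕ b) (toℕ a))
      ... | inj₁ cd≡fd = a≢b (toℕ-injective (fd≡0⇒≡ (toℕ<n a) (toℕ<n b) (trans (sym cd≡fd) cd≡0)))
      ... | inj₂ cd≡fd = a≢b (sym (toℕ-injective (fd≡0⇒≡ (toℕ<n b) (toℕ<n a) (trans (sym cd≡fd) cd≡0))))

  cd-closed : ∀ {a b : Fin t} d e → toℕ a + d ≡ toℕ b → d + e ≡ t → cd a b ≡ d ⊓ e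
  cd-closed {a} {b} zero e a≡b _ = cong (_⊓ fd (toℕ b) (toℕ a)) (fd-+ (toℕ<n a) (toℕ<n b) a≡b)
  cd-closed {a} {b} d@(suc _) e a+d≡b d+e≡t =
    cong₂ _⊓_ (fd-+ (toℕ<n a) (toℕ<n b) a+d≡b) (fd-≡ (toℕ<n b) e<t (begin
      e + toℕ b        ≡⟨ cong (e +_) a+d≡b ⟨
      e + (toℕ a + d)  ≡⟨ x∙yz≈zx∙y e (toℕ a) d ⟩
      d + e + toℕ a    ≡⟨ cong (_+ toℕ a) d+e≡t ⟩
      t + toℕ a        ≡⟨ +-comm t (toℕ a) ⟩
      toℕ a + t        ≈⟨ +t-≈ (toℕ a) ⟩
      toℕ a            ∎))
    where
      open SetoidReasoning ≈-setoid
      e<t : e < t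
      e<t = subst (e <_) d+e≡t (m<n+m e z<s)

  Dist-≤-complement : ∀ {z x : Fin t} {k} → z ≢ x → Dist (Cycle t) z x k →
                      fd (toℕ z) (toℕ x) + k ≤ t
  Dist-≤-complement {z} {x} {k} z≢x (_ , k-min) = begin
      L + k                   ≤⟨ +-monoʳ-≤ L (k-min _ backward) ⟩
      L + fd (toℕ x) (toℕ z)  ≡⟨ cong (L +_) (fd-flip (toℕ<n z) (toℕ<n x) 0<L) ⟩
      L + (t ∸ L)             ≡⟨ m+[n∸m]≡n (<⇒≤ (fd<t (toℕ z) (toℕ x))) ⟩
      t                       ∎
    where
      open ≤-Reasoning
      L : ℕ
      L = fd (toℕ z) (toℕ x)
      0<L : 0 < L
      0<L = n≢0⇒n>0 (z≢x ∘ toℕ-injective ∘ fd≡0⇒≡ (toℕ<n z) (toℕ<n x))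
      backward : Walk (Cycle t) z x (fd (toℕ x) (toℕ z))
      backward = walk-reverse Cycle-sym (forward-walk _ (fd-correct (toℕ z) (toℕ<n x)))

  OnArc : Fin t → ℕ → Fin t → Set
  OnArc z M a = fd (toℕ z) (toℕ a) ≤ M

  onArc? : ∀ z M → Decidable (OnArc z M)
  onArc? z M a = fd (toℕ z) (toℕ a) ≤? M

  fd-mono-≤ : ∀ {z a x} → z ≤ a → a ≤ x → x < t → fd z a ≤ fd z x
  fd-mono-≤ {z} {a} {x} z≤a a≤x x<t = begin
      fd z a  ≡⟨ ≤⇒fd≡∸ z≤a (≤-<-trans a≤x x<t) ⟩
      a ∸ z   ≤⟨ ∸-monoˡ-≤ z a≤x ⟩
      x ∸ z   ≡⟨ ≤⇒fd≡∸ (≤-trans z≤a a≤x) x<t ⟨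
      fd z x  ∎
    where open ≤-Reasoning

  fd-≤-outside-gap : ∀ {z a x} → x < z → z < t → a < t → a ≤ x ⊎ z ≤ a → fd z a ≤ fd z x
  fd-≤-outside-gap {z} {a} {x} x<z z<t a<t (inj₁ a≤x) = begin
      fd z a     ≡⟨ >⇒fd≡∸+ (≤-<-trans a≤x x<z) z<t ⟩
      t ∸ z + a  ≤⟨ +-monoʳ-≤ (t ∸ z) a≤x ⟩
      t ∸ z + x  ≡⟨ >⇒fd≡∸+ x<z z<t ⟨
      fd z x     ∎
    where open ≤-Reasoning
  fd-≤-outside-gap {z} {a} {x} x<z z<t a<t (inj₂ z≤a) = begin
      fd z a     ≡⟨ ≤⇒fd≡∸ z≤a a<t ⟩
      a ∸ z      ≤⟨ ∸-monoˡ-≤ z (<⇒≤ a<t) ⟩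
      t ∸ z      ≤⟨ m≤m+n (t ∸ z) x ⟩
      t ∸ z + x  ≡⟨ >⇒fd≡∸+ x<z z<t ⟨
      fd z x     ∎
    where open ≤-Reasoning

  arc-far : ∀ {M δ D} (z a j : Fin t) → OnArc z M a → fd (toℕ z) (toℕ j) ≡ M + δ →
            D ≤ δ → 0 < D → M + δ + D ≤ t → D ≤ cd a j
  arc-far {M} {δ} {D} z a j a∈arc z→j D≤δ 0<D room = ⊓-glb D≤fd-aj D≤fd-ja
    where
      open ≤-Reasoning
      α β : ℕ
      α = fd (toℕ z) (toℕ a)
      β = M + δ
      α<β : α < β
      α<β = ≤-<-trans a∈arc (m<m+n M (<-≤-trans 0<D D≤δ))
      β<t : β < t
      β<t = <-≤-trans (m<m+n β 0<D) room
      D≤fd-aj : D ≤ fd (toℕ a) (toℕ j)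
      D≤fd-aj = begin
        D                       ≤⟨ D≤δ ⟩
        δ                       ≡⟨ m+n∸m≡n M δ ⟨
        β ∸ M                   ≤⟨ ∸-monoʳ-≤ β a∈arc ⟩
        β ∸ α                   ≡⟨ ≤⇒fd≡∸ (<⇒≤ α<β) β<t ⟨
        fd α β                  ≡⟨ cong (fd α) z→j ⟨
        fd α (fd (toℕ z) (toℕ j))  ≡⟨ fd-relative (toℕ j) (toℕ<n z) (toℕ<n a) ⟨
        fd (toℕ a) (toℕ j)      ∎
      D≤fd-ja : D ≤ fd (toℕ j) (toℕ a)
      D≤fd-ja = begin
        D                       ≤⟨ m+n≤o⇒m≤o∸n D (subst (_≤ t) (+-comm β D) room) ⟩
        t ∸ β                   ≤⟨ m≤m+n (t ∸ β) α ⟩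
        t ∸ β + α               ≡⟨ >⇒fd≡∸+ α<β β<t ⟨
        fd β α                  ≡⟨ cong (λ r → fd r α) z→j ⟨
        fd (fd (toℕ z) (toℕ j)) α  ≡⟨ fd-relative (toℕ a) (toℕ<n z) (toℕ<n j) ⟨
        fd (toℕ j) (toℕ a)      ∎

  far-vertex : ∀ {M D} (z c : Fin t) → 0 < D → M + D + D < t →
               ∃[ j ] j ≢ c × (∀ a → OnArc z M a → D ≤ cd a j)
  far-vertex {M} {D} z c 0<D gap = pick (z ⊕ (M + D) ≟ᶠ c)
    where
      room′ : M + suc D + D ≤ t
      room′ = subst (λ r → r + D ≤ t) (sym (+-suc M D)) gap
      M+D<t : M + D < t
      M+D<t = ≤-<-trans (m≤m+n (M + D) D) gap
      M+1+D<t : M + suc D < t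
      M+1+D<t = <-≤-trans (m<m+n (M + suc D) 0<D) room′
      pick : Dec (z ⊕ (M + D) ≡ c) → ∃[ j ] j ≢ c × (∀ a → OnArc z M a → D ≤ cd a j)
      pick (no j≢c) = z ⊕ (M + D) , j≢c ,
        λ a a∈arc → arc-far z a _ a∈arc (fd-⊕ z M+D<t) ≤-refl 0<D (<⇒≤ gap)
      pick (yes j≡c) = z ⊕ (M + suc D) , j′≢c ,
        λ a a∈arc → arc-far z a _ a∈arc (fd-⊕ z M+1+D<t) (n≤1+n D) 0<D room′
        where
          j′≢c : z ⊕ (M + suc D) ≢ c
          j′≢c j′≡c = 1+n≢n (sym (+-cancelˡ-≡ M D (suc D) (begin
            M + D                                  ≡⟨ fd-⊕ z M+D<t ⟨
            fd (toℕ z) (toℕ (z ⊕ (M + D)))         ≡⟨ cong (λ j → fd (toℕ z) (toℕ j)) (trans j≡c (sym j′≡c)) ⟩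
            fd (toℕ z) (toℕ (z ⊕ (M + suc D)))     ≡⟨ fd-⊕ z M+1+D<t ⟩
            M + suc D                              ∎)))
            where open ≡-Reasoning

m⊓1+n≡1+m⊓n⇒m≡n : ∀ {m n} → m ⊓ suc n ≡ suc m ⊓ n → m ≡ n
m⊓1+n≡1+m⊓n⇒m≡n {zero}  {zero}  _  = refl
m⊓1+n≡1+m⊓n⇒m≡n {suc m} {suc n} eq = cong suc (m⊓1+n≡1+m⊓n⇒m≡n (suc-injective eq))

module Landmarks (t′ : ℕ) where

  open CycleMetric (2 + t′)

  v₀ v₁ : Fin (2 + t′)
  v₀ = zero
  v₁ = suc zero

  -- If v₀ is equidistant from p and p+1, the two are antipodal to v₀, which v₁ is not.
  resolve-successor : ∀ {p q : Fin (2 + t′)} → suc (toℕ p) ≡ toℕ q →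
                      cd v₀ p ≢ cd v₀ q ⊎ cd v₁ p ≢ cd v₁ q
  resolve-successor {p} {q} 1+p≡q with cd v₀ p ≟ cd v₀ q
  ... | no  ≢₀ = inj₁ ≢₀
  ... | yes ≡₀ = inj₂ ≢₁
    where
      open ≡-Reasoning
      P o : ℕ
      P = toℕ p
      2+P≤t : suc (suc P) ≤ 2 + t′
      2+P≤t = subst (_< 2 + t′) (sym 1+p≡q) (toℕ<n q)
      o = proj₁ (m≤n⇒∃[o]m+o≡n 2+P≤t)
      2+P+o≡t : suc (suc P) + o ≡ 2 + t′
      2+P+o≡t = proj₂ (m≤n⇒∃[o]m+o≡n 2+P≤t)
      P≡1+o : P ≡ suc o
      P≡1+o = m⊓1+n≡1+m⊓n⇒m≡n (begin
          P ⊓ suc (suc o)      ≡⟨ cd-closed {v₀} {p} P _ refl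
                                    (trans (trans (+-suc P (suc o)) (cong suc (+-suc P o))) 2+P+o≡t) ⟨
          cd v₀ p              ≡⟨ ≡₀ ⟩
          cd v₀ q              ≡⟨ cd-closed {v₀} {q} (suc P) _ 1+p≡q (trans (cong suc (+-suc P o)) 2+P+o≡t) ⟩
          suc P ⊓ suc o        ∎)
      3+o+o≡t : suc (suc (suc o)) + o ≡ 2 + t′
      3+o+o≡t = trans (cong (λ r → suc (suc r) + o) (sym P≡1+o)) 2+P+o≡t
      ≢₁ : cd v₁ p ≢ cd v₁ q
      ≢₁ ≡₁ = o≢2+o (m⊓1+n≡1+m⊓n⇒m≡n (begin
          o ⊓ suc (suc (suc o))  ≡⟨ cd-closed {v₁} {p} o _ (sym P≡1+o) (trans (+-comm o _) 3+o+o≡t) ⟨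
          cd v₁ p                ≡⟨ ≡₁ ⟩
          cd v₁ q                ≡⟨ cd-closed {v₁} {q} (suc o) _ (trans (cong suc (sym P≡1+o)) 1+p≡q)
                                      (trans (cong suc (+-comm o _)) 3+o+o≡t) ⟩
          suc o ⊓ suc (suc o)    ∎))
        where
          o≢2+o : o ≢ suc (suc o)
          o≢2+o o≡2+o = <-irrefl o≡2+o (<-trans (n<1+n o) (n<1+n (suc o)))

  resolve-wrap : ∀ {p q : Fin (2 + t′)} → toℕ q ≡ 0 → suc (toℕ p) ≡ 2 + t′ → cd v₀ p ≢ cd v₀ q
  resolve-wrap {p} {q} q≡0 1+p≡t cd≡ = 1+n≢0 (begin
      suc (t′ ⊓ 0)  ≡⟨ cd-closed {v₀} {p} (suc t′) 1 (sym (suc-injective 1+p≡t)) (cong suc (+-comm t′ 1)) ⟨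
      cd v₀ p       ≡⟨ cd≡ ⟩
      cd v₀ q       ≡⟨ cd-closed {v₀} {q} 0 (2 + t′) (sym q≡0) refl ⟩
      0             ∎)
    where open ≡-Reasoning

  landmarks-resolve : ∀ {p q : Fin (2 + t′)} → Cycle (2 + t′) p q →
                      cd v₀ p ≢ cd v₀ q ⊎ cd v₁ p ≢ cd v₁ q
  landmarks-resolve (inj₁ 1+p≡q)                       = resolve-successor 1+p≡q
  landmarks-resolve (inj₂ (inj₁ 1+q≡p))                = Sum.map ≢-sym ≢-sym (resolve-successor 1+q≡p)
  landmarks-resolve (inj₂ (inj₂ (inj₁ (p≡0 , 1+q≡t)))) = inj₁ (≢-sym (resolve-wrap p≡0 1+q≡t))
  landmarks-resolve (inj₂ (inj₂ (inj₂ (q≡0 , 1+p≡t)))) = inj₁ (resolve-wrap q≡0 1+p≡t)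

-- Counting in lists

module _ {A : Set} {P : A → Set} (P? : Decidable P) where

  filter-length≡0 : ∀ (xs : List A) → (∀ m → ¬ P (lookup xs m)) → length (filter P? xs) ≡ 0
  filter-length≡0 []       _  = refl
  filter-length≡0 (x ∷ xs) ¬P =
    trans (cong length (filter-reject P? (¬P zero))) (filter-length≡0 xs (¬P ∘ suc))

  filter-length≤1 : ∀ (xs : List A) (i : Fin (length xs)) →
                    (∀ m → m ≢ i → ¬ P (lookup xs m)) → length (filter P? xs) ≤ 1
  filter-length≤1 (x ∷ xs) zero ¬P with P? x
  ... | yes _ = s≤s (≤-reflexive (filter-length≡0 xs λ m → ¬P (suc m) λ ()))
  ... | no  _ = ≤-trans (≤-reflexive (filter-length≡0 xs λ m → ¬P (suc m) λ ())) z≤n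
  filter-length≤1 (x ∷ xs) (suc i) ¬P =
    subst (_≤ 1) (sym (cong length (filter-reject P? (¬P zero λ ()))))
      (filter-length≤1 xs i λ m m≢i → ¬P (suc m) λ { refl → m≢i refl })

  filter-map-length≤1⇒unique : ∀ {B : Set} (f : B → A) → B → (ys : List B) →
                               length (filter P? (map f ys)) ≤ 1 →
                               ∃[ y ] ∀ {x} → x ∈ ys → P (f x) → x ≡ y
  filter-map-length≤1⇒unique f y₀ []       _ = y₀ , λ ()
  filter-map-length≤1⇒unique f y₀ (y ∷ ys) h with P? (f y)
  ... | yes _ = y , λ { (here refl) _ → refl ; (there x∈ys) Pfx → ⊥-elim (none x∈ys Pfx) }
    where
      none : ∀ {x} → x ∈ ys → ¬ P (f x)
      none x∈ys Pfx = <⇒≱ (filter-some P? (Any.map (λ { refl → Pfx }) (∈-map⁺ f x∈ys))) (≤-pred h)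
  ... | no ¬Pfy with filter-map-length≤1⇒unique f y₀ ys h
  ...   | y′ , unique = y′ , λ { (here refl) Pfx → ⊥-elim (¬Pfy Pfx) ; (there x∈ys) → unique x∈ys }

-- Sorted lists of cycle vertices

toℕ-plus2 : ∀ {b} (l : Fin (suc b)) → toℕ (plus2 l) ≡ (toℕ l + 2) % suc b
toℕ-plus2 l = toℕ-fromℕ< _

plus2-moves⇒3≤length : ∀ {A : Set} (xs : List A) (l : Fin (length xs)) →
                       lookup xs (plus2 l) ≢ lookup xs l → 3 ≤ length xs
plus2-moves⇒3≤length (_ ∷ [])        zero       moved = ⊥-elim (moved refl)
plus2-moves⇒3≤length (_ ∷ _ ∷ [])    zero       moved = ⊥-elim (moved refl)
plus2-moves⇒3≤length (_ ∷ _ ∷ [])    (suc zero) moved = ⊥-elim (moved refl)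
plus2-moves⇒3≤length (_ ∷ _ ∷ _ ∷ _) _          _     = s≤s (s≤s (s≤s z≤n))

module _ (t : ℕ) .{{_ : NonZero t}} where

  open CycleMetric t

  module _ {xs : List (Fin t)} (xs↗ : Sorted (≤-totalOrder t) xs) where

    private
      mono : ∀ {i j} → toℕ i ≤ toℕ j → toℕ (lookup xs i) ≤ toℕ (lookup xs j)
      mono = lookup-mono-≤ (≤-totalOrder t) xs↗

    on-arc-within : ∀ {p q m} → toℕ p ≤ toℕ m → toℕ m ≤ toℕ q →
                    OnArc (lookup xs p) (fd (toℕ (lookup xs p)) (toℕ (lookup xs q))) (lookup xs m)
    on-arc-within p≤m m≤q = fd-mono-≤ (mono p≤m) (mono m≤q) (toℕ<n _)

    on-arc-around : ∀ {p q m} → toℕ q ≤ toℕ p → lookup xs p ≢ lookup xs q →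
                    toℕ m ≤ toℕ q ⊎ toℕ p ≤ toℕ m →
                    OnArc (lookup xs p) (fd (toℕ (lookup xs p)) (toℕ (lookup xs q))) (lookup xs m)
    on-arc-around q≤p xp≢xq m-outside =
      fd-≤-outside-gap (≤∧≢⇒< (mono q≤p) (xp≢xq ∘ sym ∘ toℕ-injective)) (toℕ<n _) (toℕ<n _)
        (Sum.map mono mono m-outside)

  sorted⇒on-arc : (xs : List (Fin t)) → Sorted (≤-totalOrder t) xs → 3 ≤ length xs →
                  (l : Fin (length xs)) → lookup xs (plus2 l) ≢ lookup xs l →
                  ∃[ mid ] ∀ m → m ≢ mid →
                    OnArc (lookup xs (plus2 l)) (fd (toℕ (lookup xs (plus2 l))) (toℕ (lookup xs l)))
                          (lookup xs m)
  sorted⇒on-arc (_ ∷ [])     _ (s≤s ())       _ _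
  sorted⇒on-arc (_ ∷ _ ∷ []) _ (s≤s (s≤s ())) _ _
  sorted⇒on-arc xs@(_ ∷ _ ∷ _ ∷ _) xs↗ _ l z≢x = cases (<-cmp (i + 2) b)
    where
      i b : ℕ
      i = toℕ l
      b = length xs
      Goal : Set
      Goal = ∃[ mid ] ∀ m → m ≢ mid →
               OnArc (lookup xs (plus2 l)) (fd (toℕ (lookup xs (plus2 l))) (toℕ (lookup xs l)))
                     (lookup xs m)
      ≢-index : ∀ {m} (1+i<b : suc i < b) → m ≢ fromℕ< 1+i<b → toℕ m ≢ suc i
      ≢-index 1+i<b m≢mid m≡1+i = m≢mid (toℕ-injective (trans m≡1+i (sym (toℕ-fromℕ< 1+i<b))))
      cases : Tri (i + 2 < b) (i + 2 ≡ b) (b < i + 2) → Goal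
      cases (tri< i+2<b _ _) = fromℕ< 1+i<b , λ m m≢mid →
          on-arc-around xs↗ (subst (i ≤_) (sym p≡2+i) (m≤n+m i 2)) z≢x
            (Sum.map₂ (subst (_≤ toℕ m) (sym p≡2+i)) (around m m≢mid))
        where
          p≡2+i : toℕ (plus2 l) ≡ suc (suc i)
          p≡2+i = trans (toℕ-plus2 l) (trans (m<n⇒m%n≡m i+2<b) (+-comm i 2))
          1+i<b : suc i < b
          1+i<b = <-trans (n<1+n (suc i)) (subst (_< b) (+-comm i 2) i+2<b)
          around : ∀ m → m ≢ fromℕ< 1+i<b → toℕ m ≤ i ⊎ suc (suc i) ≤ toℕ m
          around m m≢mid with <-cmp (toℕ m) (suc i)
          ... | tri< m<1+i _ _ = inj₁ (≤-pred m<1+i)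
          ... | tri≈ _ m≡1+i _ = ⊥-elim (≢-index 1+i<b m≢mid m≡1+i)
          ... | tri> _ _ 1+i<m = inj₂ 1+i<m
      cases (tri≈ _ i+2≡b _) = fromℕ< 1+i<b , λ m m≢mid →
          on-arc-within xs↗ (subst (_≤ toℕ m) (sym p≡0) z≤n)
            (≤-pred (≤∧≢⇒< (≤-pred (subst (toℕ m <_) (sym 2+i≡b) (toℕ<n m))) (≢-index 1+i<b m≢mid)))
        where
          2+i≡b : suc (suc i) ≡ b
          2+i≡b = trans (+-comm 2 i) i+2≡b
          p≡0 : toℕ (plus2 l) ≡ 0
          p≡0 = trans (toℕ-plus2 l) (trans (cong (_% b) i+2≡b) (n%n≡0 b))
          1+i<b : suc i < b
          1+i<b = subst (suc i <_) 2+i≡b (n<1+n (suc i))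
      cases (tri> _ _ b<i+2) = zero , λ m m≢0 →
          on-arc-within xs↗ (subst (_≤ toℕ m) (sym p≡1) (1≤m m m≢0))
            (≤-pred (subst (toℕ m <_) (sym 1+i≡b) (toℕ<n m)))
        where
          1+i≡b : suc i ≡ b
          1+i≡b = ≤-antisym (toℕ<n l) (≤-pred (subst (b <_) (+-comm i 2) b<i+2))
          p≡1 : toℕ (plus2 l) ≡ 1
          p≡1 = trans (toℕ-plus2 l) (trans (cong (_% b) (trans (+-comm i 2) (cong suc 1+i≡b)))
                  (trans ([m+n]%n≡m%n 1 b) (m<n⇒m%n≡m {n = b} (s≤s (s≤s z≤n)))))
          1≤m : ∀ m → m ≢ zero → 1 ≤ toℕ m
          1≤m zero    m≢0 = ⊥-elim (m≢0 refl)
          1≤m (suc _) _   = s≤s z≤n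

-- The strong product C_t ⊠ G

module _ {V : Set} (G : Graph V) (loopless : ∀ x → ¬ G x x) (conn : Connected G)
         {D : ℕ} (diam : IsDiameter G D) (t : ℕ) .{{_ : NonZero t}} where

  open CycleMetric t

  private
    ¬¬short-walk : ∀ x y → ¬ ¬ (∃[ m ] m ≤ D × Walk G x y m)
    ¬¬short-walk = ¬¬walk-within-diameter conn diam

  ¬¬diameter-pos : ∀ {x y} → G x y → ¬ ¬ (0 < D)
  ¬¬diameter-pos {x} {y} x~y ¬pos = ¬¬short-walk x y λ where
    (zero  , _   , w) → loopless x (subst (G x) (sym (walk₀⇒≡ w)) x~y)
    (suc _ , m≤D , _) → ¬pos (≤-trans (s≤s z≤n) m≤D)

  -- (a, h) is at distance cd a j from (j, y) once d_G(h, y) ≤ cd a j: for a on the arc this holds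
  -- for y = h₀, g as D ≤ cd a j, and for the exceptional vertex (c, h₀) because j ≢ c.
  unresolved-pair : (B : List (Fin t × V)) → IsLocalMetricGenerator (StrongProduct (Cycle t) G) B →
                    ∀ {z M c h₀ g j} → (∀ {s} → s ∈ B → ¬ OnArc z M (proj₁ s) → s ≡ (c , h₀)) →
                    G h₀ g → j ≢ c → (∀ a → OnArc z M a → D ≤ cd a j) → ⊥
  unresolved-pair B generates {z} {M} {c} {h₀} {g} {j} off-arc⇒≡ h₀~g j≢c far
    with generates (j , h₀) (j , g) (inj₁ (refl , h₀~g))
  ... | (a , h) , s∈B , _ , _ , d₁ , d₂ , k₁≢k₂ with onArc? z M a
  ...   | yes a∈arc =
          ¬¬short-walk h h₀ λ (m₁ , m₁≤D , w₁) → ¬¬short-walk h g λ (m₂ , m₂≤D , w₂) →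
          k₁≢k₂ (⊠-equidistant (Dist-cd a j) w₁ (≤-trans m₁≤D (far a a∈arc))
                                             w₂ (≤-trans m₂≤D (far a a∈arc)) d₁ d₂)
  ...   | no a∉arc with off-arc⇒≡ s∈B a∉arc
  ...     | refl = k₁≢k₂ (⊠-equidistant (Dist-cd c j) here z≤n (step h₀~g here) (cd-pos (≢-sym j≢c)) d₁ d₂)

  generator-off-arc≤1⇒complement≤2D : V → (∀ x → ∃ (G x)) → (B : List (Fin t × V)) →
                  IsLocalMetricGenerator (StrongProduct (Cycle t) G) B →
                  ∀ z M → length (filter (∁? (onArc? z M)) (map proj₁ B)) ≤ 1 → ¬ (M + D + D < t)
  generator-off-arc≤1⇒complement≤2D v neighbour B generates z M few-off-arc gap
    with filter-map-length≤1⇒unique (∁? (onArc? z M)) proj₁ (z , v) B few-off-arc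
  ... | (c , h₀) , off-arc⇒≡ with neighbour h₀
  ...   | g , h₀~g = ¬¬diameter-pos h₀~g λ 0<D →
          let (j , j≢c , far) = far-vertex z c 0<D gap
          in  unresolved-pair B generates {z} {M} off-arc⇒≡ h₀~g j≢c far

module _ (t′ : ℕ) (G : Graph (Fin 1)) (loopless : ∀ x → ¬ G x x) where

  open CycleMetric (2 + t′)
  open Landmarks t′

  landmark-generator : IsLocalMetricGenerator (StrongProduct (Cycle (2 + t′)) G)
                                              ((v₀ , zero) ∷ (v₁ , zero) ∷ [])
  landmark-generator (p , zero) (q , zero) (inj₁ (_ , loop))        = ⊥-elim (loopless zero loop)
  landmark-generator (p , zero) (q , zero) (inj₂ (inj₂ (_ , loop))) = ⊥-elim (loopless zero loop)
  landmark-generator (p , zero) (q , zero) (inj₂ (inj₁ (_ , p~q))) with landmarks-resolve p~q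
  ... | inj₁ ≢₀ = (v₀ , zero) , here refl , _ , _ ,
                  Dist-⊠ (Dist-cd v₀ p) here z≤n , Dist-⊠ (Dist-cd v₀ q) here z≤n , ≢₀
  ... | inj₂ ≢₁ = (v₁ , zero) , there (here refl) , _ , _ ,
                  Dist-⊠ (Dist-cd v₁ p) here z≤n , Dist-⊠ (Dist-cd v₁ q) here z≤n , ≢₁

  basis-length≤2 : ∀ {B} → IsLocalMetricBasis (StrongProduct (Cycle (2 + t′)) G) B → length B ≤ 2
  basis-length≤2 (_ , _ , minimal) = minimal _ (((λ ()) ∷ []) ∷ [] ∷ []) landmark-generator

basis-off-arc≤1⇒complement≤2D : ∀ t′ n (G : Graph (Fin n)) → (∀ x → ¬ G x x) → Connected G → ∀ {D} → IsDiameter G D →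
              (B : List (Fin (3 + t′) × Fin n)) → IsLocalMetricBasis (StrongProduct (Cycle (3 + t′)) G) B →
              3 ≤ length B → ∀ z M →
              length (filter (∁? (CycleMetric.onArc? (3 + t′) z M)) (map proj₁ B)) ≤ 1 →
              ¬ (M + D + D < 3 + t′)
basis-off-arc≤1⇒complement≤2D t′ zero          G loopless conn (_ , () , _)
basis-off-arc≤1⇒complement≤2D t′ (suc zero)    G loopless conn diam B basis 3≤|B| _ _ _ _ =
  <⇒≱ 3≤|B| (basis-length≤2 (suc t′) G loopless basis)
basis-off-arc≤1⇒complement≤2D t′ (suc (suc n)) G loopless conn diam B (_ , generates , _) _ =
  generator-off-arc≤1⇒complement≤2D G loopless conn diam (3 + t′) zero (connected⇒no-isolated conn other) B generates
  where
    other : ∀ (x : Fin (suc (suc n))) → ∃[ y ] x ≢ y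
    other zero    = suc zero , λ ()
    other (suc _) = zero , λ ()

lemma20 : (n : ℕ) (G : Graph (Fin n)) → IsSimple G → Connected G →
          (D : ℕ) → IsDiameter G D →
          (t : ℕ) → 3 ≤ t →
          (B : List (Fin t × Fin n)) → IsLocalMetricBasis (StrongProduct (Cycle t) G) B →
          (is : List (Fin t)) → is ↭ map proj₁ B → Sorted (≤-totalOrder t) is →
          (l : Fin (length is)) (k : ℕ) →
          Dist (Cycle t) (lookup is (plus2 l)) (lookup is l) k →
          k ≤ 2 * D
lemma20 n G (_ , loopless) conn D diam (suc (suc (suc t′))) (s≤s (s≤s (s≤s _))) B basis is is↭B is↗ l k dist
  with lookup is (plus2 l) ≟ᶠ lookup is l
... | yes z≡x = ≤-trans (proj₂ dist 0 (subst (λ z → Walk (Cycle _) z (lookup is l) 0) (sym z≡x) here)) z≤n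
... | no  z≢x = ≮⇒≥ λ 2D<k → basis-off-arc≤1⇒complement≤2D t′ n G loopless conn diam B basis 3≤|B| z M few-off-arc (gap 2D<k)
  where
    open CycleMetric (3 + t′)
    z : Fin (3 + t′)
    z = lookup is (plus2 l)
    M : ℕ
    M = fd (toℕ z) (toℕ (lookup is l))
    3≤|is| : 3 ≤ length is
    3≤|is| = plus2-moves⇒3≤length is l z≢x
    3≤|B| : 3 ≤ length B
    3≤|B| = subst (3 ≤_) (trans (↭-length is↭B) (length-map proj₁ B)) 3≤|is|
    few-off-arc : length (filter (∁? (onArc? z M)) (map proj₁ B)) ≤ 1
    few-off-arc with sorted⇒on-arc (3 + t′) is is↗ 3≤|is| l z≢x
    ... | mid , on-arc = subst (_≤ 1) (↭-length (filter-↭ (∁? (onArc? z M)) is↭B))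
                           (filter-length≤1 (∁? (onArc? z M)) is mid λ m m≢mid off → off (on-arc m m≢mid))
    gap : 2 * D < k → M + D + D < 3 + t′
    gap 2D<k = begin-strict
      M + D + D    ≡⟨ +-assoc M D D ⟩
      M + (D + D)  ≡⟨ cong (λ r → M + (D + r)) (+-identityʳ D) ⟨
      M + 2 * D    <⟨ +-monoʳ-< M 2D<k ⟩
      M + k        ≤⟨ Dist-≤-complement z≢x dist ⟩
      3 + t′       ∎
      where open ≤-Reasoning
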